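{- Let $n \geqslant 5$ be an integer and let $G$ be a plane graph on $n$ vertices with minimum degree $\delta(G) \geqslant 3$ that contains neither $K_4$ nor $\Theta_5$ as a subgraph. Then $$e(G) \leqslant \frac{25}{11}(n-2).$$
   Context: Graphs are simple; $e(G)$ is the number of edges of $G$. $\Theta_5$ denotes the Theta graph on $5$ vertices: a cycle $C_5$ together with one additional edge joining two non-consecutive vertices of the cycle. -}

module Defs where

open import Data.Bool using (Bool; true; false; _∧_; _∨_; if_then_else_)
open import Data.Nat using (ℕ; zero; suc; _+_; _*_; _≤ᵇ_; _<_)
open import Data.Fin using (Fin; zero; suc; toℕ; _≟_)
open import Data.Product using (_×_; _,_; proj₁; proj₂; ∃)
open import Function using (_∘_)
open import Relation.Binary.PropositionalEquality using (_≡_)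
open import Relation.Nullary.Decidable using (⌊_⌋)

record Graph (n : ℕ) : Set where
  field
    adj    : Fin n → Fin n → Bool
    sym    : ∀ u v → adj u v ≡ adj v u
    irrefl : ∀ v → adj v v ≡ false
open Graph public

countF : ∀ {n} → (Fin n → Bool) → ℕ
countF {zero}  p = 0
countF {suc n} p = (if p zero then 1 else 0) + countF (p ∘ suc)

sumF : ∀ {n} → (Fin n → ℕ) → ℕ
sumF {zero}  f = 0
sumF {suc n} f = f zero + sumF (f ∘ suc)

anyF : ∀ {n} → (Fin n → Bool) → Bool
anyF {zero}  p = false
anyF {suc n} p = p zero ∨ anyF (p ∘ suc)

allBelow : ℕ → (ℕ → Bool) → Bool
allBelow zero    p = true
allBelow (suc k) p = p k ∧ allBelow k p

iter : ∀ {A : Set} → (A → A) → ℕ → A → A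
iter f zero    x = x
iter f (suc k) x = f (iter f k x)

e : ∀ {n} → Graph n → ℕ
e G = sumF (λ u → countF (λ v → (suc (toℕ u) ≤ᵇ toℕ v) ∧ adj G u v))

deg : ∀ {n} → Graph n → Fin n → ℕ
deg G v = countF (adj G v)

MinDegAtLeast : ∀ {n} → ℕ → Graph n → Set
MinDegAtLeast {n} d G = ∀ (v : Fin n) → d Data.Nat.≤ deg G v

-- (not necessarily induced) subgraph containment via injective vertex maps
Injective : ∀ {k n} → (Fin k → Fin n) → Set
Injective f = ∀ i j → f i ≡ f j → i ≡ j

ContainsK4 : ∀ {n} → Graph n → Set
ContainsK4 {n} G = ∃ λ (f : Fin 4 → Fin n) → Injective f ×
  (∀ i j → (i ≡ j → Data.Empty.⊥) → adj G (f i) (f j) ≡ true)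
  where import Data.Empty

v0 v1 v2 v3 v4 : Fin 5
v0 = zero
v1 = suc zero
v2 = suc (suc zero)
v3 = suc (suc (suc zero))
v4 = suc (suc (suc (suc zero)))

ContainsΘ5 : ∀ {n} → Graph n → Set
ContainsΘ5 {n} G = ∃ λ (f : Fin 5 → Fin n) → Injective f ×
  (adj G (f v0) (f v1) ≡ true × adj G (f v1) (f v2) ≡ true ×
   adj G (f v2) (f v3) ≡ true × adj G (f v3) (f v4) ≡ true ×
   adj G (f v4) (f v0) ≡ true × adj G (f v0) (f v2) ≡ true)

-- ===== Combinatorial embeddings (rotation systems) =====
-- ρ u : cyclic successor on the neighbourhood of u (values outside N(u) irrelevant)
record RotationSystem {n : ℕ} (G : Graph n) : Set where
  field
    ρ      : Fin n → Fin n → Fin n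
    closed : ∀ u v → adj G u v ≡ true → adj G u (ρ u v) ≡ true
    inj    : ∀ u v w → adj G u v ≡ true → adj G u w ≡ true → ρ u v ≡ ρ u w → v ≡ w
    cyclic : ∀ u v w → adj G u v ≡ true → adj G u w ≡ true →
             ∃ λ k → iter (ρ u) k v ≡ w
open RotationSystem public

Dart : ℕ → Set
Dart n = Fin n × Fin n

faceStep : ∀ {n} {G : Graph n} → RotationSystem G → Dart n → Dart n
faceStep R (u , v) = (v , ρ R v u)

key : ∀ {n} → Dart n → ℕ
key {n} (u , v) = toℕ u * n + toℕ v

isFaceRep : ∀ {n} {G : Graph n} → RotationSystem G → Dart n → Bool
isFaceRep {n} R d = allBelow (n * n) (λ k → key d ≤ᵇ key (iter (faceStep R) k d))

faces : ∀ {n} {G : Graph n} → RotationSystem G → ℕ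
faces {G = G} R = sumF (λ u → countF (λ v → adj G u v ∧ isFaceRep R (u , v)))

reach : ∀ {n} → Graph n → ℕ → Fin n → Fin n → Bool
reach G zero    v w = ⌊ v ≟ w ⌋
reach G (suc k) v w = reach G k v w ∨ anyF (λ x → reach G k v x ∧ adj G x w)

isCompRep : ∀ {n} → Graph n → Fin n → Bool
isCompRep {n} G v =
  Data.Bool.not (anyF (λ w → reach G n v w ∧ (suc (toℕ w) ≤ᵇ toℕ v)))
  where import Data.Bool

components : ∀ {n} → Graph n → ℕ
components G = countF (isCompRep G)

isolated : ∀ {n} → Graph n → ℕ
isolated G = countF (λ v → deg G v Data.Nat.≡ᵇ 0)

-- Plane graph: G admits a rotation system of genus 0 on every component,
-- i.e. Euler's formula Σ_components (V - E + F) = 2·c, where an isolated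
-- vertex (no darts, hence no faces in the dart model) contributes 1 face.
Planar : ∀ {n} → Graph n → Set
Planar {n} G = ∃ λ (R : RotationSystem G) →
  n + faces R + isolated G ≡ e G + 2 * components G

-- Discharging on darts. Every face receives charge 300, shared equally by the darts tracing it,
-- so a dart of a triangle, a quadrangle or a longer face holds 100, 75 or at most 60. A dart of a
-- face of length ≥ 5 passes 24 across its edge to an opposite triangle, and a triangle dart whose
-- opposite face is long passes 8 to each of the other two darts of its triangle. With δ ≥ 3 and no
-- K₄ or Θ₅, a triangular face borders no quadrangle and at most one other triangle, so afterwards
-- every dart holds at most 84. Hence 300 f ≤ 84 · 2e, i.e. 25 f ≤ 14 e, and Euler's formula
-- n + f ≥ e + 2 turns this into 11 e ≤ 25 (n − 2).
module Submission where

open import Defs hiding (sym)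
open import Data.Nat using (ℕ; zero; suc; _+_; _*_; _∸_; _≤_; _<_; z≤n; s≤s; _≤ᵇ_; _≡ᵇ_)
open import Data.Nat.Properties
open import Data.Nat.Tactic.RingSolver using (solve-∀)
open import Algebra.Properties.Semiring.Sum +-*-semiring
  using (sum; sum-cong-≗; sum-remove; ∑-distrib-+; *-distribˡ-sum)
open import Data.Bool using (Bool; true; false; _∧_; _∨_; not; if_then_else_)
open import Data.Bool.Properties using (∧-zeroʳ; ∧-identityʳ; ∨-zeroʳ; T-≡)
open import Data.Empty using (⊥; ⊥-elim)
open import Data.Fin as Fin using (Fin; zero; suc; toℕ; punchIn; punchOut; combine; remQuot; _↑ˡ_; _↑ʳ_)
open import Data.Fin.Properties
  using (punchIn-punchOut; punchOut-injective; remQuot-combine; combine-remQuot; combine-injective;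
         toℕ-combine; toℕ-injective; toℕ<n; pigeonhole)
  renaming (suc-injective to fsuc-injective)
open import Data.Product using (_×_; _,_; proj₁; proj₂; ∃)
open import Data.Product.Properties using (≡-dec)
open import Data.Sum using (_⊎_; inj₁; inj₂)
open import Data.Vec using (Vec; []; _∷_; lookup)
open import Data.Vec.Relation.Unary.All using ([]; _∷_)
open import Data.Vec.Relation.Unary.All.Properties using (lookup⁺)
open import Data.Vec.Relation.Unary.AllPairs as AllPairs using (AllPairs; []; _∷_)
open import Data.Vec.Relation.Unary.Unique.Propositional using (Unique)
open import Data.Vec.Relation.Unary.Unique.Propositional.Properties using (lookup-injective)
open import Function using (_∘_; Equivalence)
open import Relation.Binary.PropositionalEquality
open import Relation.Nullary using (¬_; Dec; yes; no; does)
open import Relation.Nullary.Decidable using (dec-true)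

ind : Bool → ℕ
ind b = if b then 1 else 0

ind-<ᵇ-connex : ∀ {x y} → x ≢ y → ind (suc x ≤ᵇ y) + ind (suc y ≤ᵇ x) ≡ 1
ind-<ᵇ-connex {zero}  {zero}  x≢y = ⊥-elim (x≢y refl)
ind-<ᵇ-connex {zero}  {suc y} _   = refl
ind-<ᵇ-connex {suc x} {zero}  _   = refl
ind-<ᵇ-connex {suc x} {suc y} x≢y = ind-<ᵇ-connex (x≢y ∘ cong suc)

sumF≡sum : ∀ {m} (f : Fin m → ℕ) → sumF f ≡ sum f
sumF≡sum {zero}  f = refl
sumF≡sum {suc m} f = cong (f zero +_) (sumF≡sum (f ∘ suc))

countF≡sum : ∀ {m} (p : Fin m → Bool) → countF p ≡ sum (ind ∘ p)
countF≡sum {zero}  p = refl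
countF≡sum {suc m} p = cong (ind (p zero) +_) (countF≡sum (p ∘ suc))

sum-mono : ∀ {m} {f g : Fin m → ℕ} → (∀ i → f i ≤ g i) → sum f ≤ sum g
sum-mono {zero}  _   = z≤n
sum-mono {suc m} f≤g = +-mono-≤ (f≤g zero) (sum-mono (f≤g ∘ suc))

sum-∘-injective : ∀ {m} (π : Fin m → Fin m) → Injective π → (g : Fin m → ℕ) → sum (g ∘ π) ≡ sum g
sum-∘-injective {zero}  π π-inj g = refl
sum-∘-injective {suc m} π π-inj g = begin
  g (π zero) + sum (g ∘ π ∘ suc)             ≡⟨ cong (g (π zero) +_) tail-sum ⟩
  g (π zero) + sum (g ∘ punchIn (π zero))    ≡⟨ sum-remove g ⟨
  sum g                                      ∎
  where
  open ≡-Reasoning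
  π₀≢π : ∀ i → π zero ≢ π (suc i)
  π₀≢π i eq with () ← π-inj zero (suc i) eq
  π′ : Fin m → Fin m
  π′ i = punchOut (π₀≢π i)
  π′-inj : Injective π′
  π′-inj i j eq = fsuc-injective (π-inj (suc i) (suc j) (punchOut-injective (π₀≢π i) (π₀≢π j) eq))
  tail-sum : sum (g ∘ π ∘ suc) ≡ sum (g ∘ punchIn (π zero))
  tail-sum = trans (sum-cong-≗ (λ i → cong g (sym (punchIn-punchOut (π₀≢π i)))))
                   (sum-∘-injective π′ π′-inj (g ∘ punchIn (π zero)))

sum-↑ : ∀ a {b} (g : Fin (a + b) → ℕ) → sum g ≡ sum (g ∘ (_↑ˡ b)) + sum (g ∘ (a ↑ʳ_))
sum-↑ zero    g = refl
sum-↑ (suc a) g = trans (cong (g zero +_) (sum-↑ a (g ∘ suc))) (sym (+-assoc (g zero) _ _))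

sum-combine : ∀ m {n} (g : Fin (m * n) → ℕ) → sum g ≡ sum λ i → sum λ j → g (combine {m} {n} i j)
sum-combine zero        g = refl
sum-combine (suc m) {n} g =
  trans (sum-↑ n g) (cong (sum (g ∘ (_↑ˡ (m * n))) +_) (sum-combine m (g ∘ (n ↑ʳ_))))

module _ {n : ℕ} where

  swap : Dart n → Dart n
  swap (u , v) = (v , u)

  flatten : Dart n → Fin (n * n)
  flatten (u , v) = combine u v

  remQuot-flatten : ∀ d → remQuot n (flatten d) ≡ d
  remQuot-flatten (u , v) = remQuot-combine u v

  ∑² : (Dart n → ℕ) → ℕ
  ∑² h = sum λ u → sum λ v → h (u , v)

  ∑²-cong : {f g : Dart n → ℕ} → (∀ d → f d ≡ g d) → ∑² f ≡ ∑² g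
  ∑²-cong f≗g = sum-cong-≗ λ u → sum-cong-≗ λ v → f≗g (u , v)

  ∑²-mono : {f g : Dart n → ℕ} → (∀ d → f d ≤ g d) → ∑² f ≤ ∑² g
  ∑²-mono f≤g = sum-mono λ u → sum-mono λ v → f≤g (u , v)

  ∑²-distrib-+ : (f g : Dart n → ℕ) → ∑² (λ d → f d + g d) ≡ ∑² f + ∑² g
  ∑²-distrib-+ f g = trans (sum-cong-≗ {n} λ u → ∑-distrib-+ (λ v → f (u , v)) (λ v → g (u , v)))
                           (∑-distrib-+ (λ u → sum λ v → f (u , v)) (λ u → sum λ v → g (u , v)))

  *-distribˡ-∑² : (c : ℕ) (f : Dart n → ℕ) → c * ∑² f ≡ ∑² (λ d → c * f d)
  *-distribˡ-∑² c f = trans (*-distribˡ-sum c (λ u → sum λ v → f (u , v)))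
                            (sum-cong-≗ {n} λ u → *-distribˡ-sum c (λ v → f (u , v)))

  ∑²≡sum-remQuot : (h : Dart n → ℕ) → ∑² h ≡ sum (h ∘ remQuot n)
  ∑²≡sum-remQuot h = sym (trans (sum-combine n (h ∘ remQuot n)) (∑²-cong (cong h ∘ remQuot-flatten)))

  ∑²-∘-injective : (π : Dart n → Dart n) → (∀ d d′ → π d ≡ π d′ → d ≡ d′) → (h : Dart n → ℕ) →
                   ∑² (h ∘ π) ≡ ∑² h
  ∑²-∘-injective π π-inj h = begin
    ∑² (h ∘ π)                ≡⟨ ∑²≡sum-remQuot (h ∘ π) ⟩
    sum (h ∘ π ∘ remQuot n)   ≡⟨ sum-cong-≗ (λ k → cong h (sym (remQuot-flatten (π (remQuot n k))))) ⟩
    sum (h ∘ remQuot n ∘ π̂)   ≡⟨ sum-∘-injective π̂ π̂-inj (h ∘ remQuot n) ⟩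
    sum (h ∘ remQuot n)       ≡⟨ ∑²≡sum-remQuot h ⟨
    ∑² h                      ∎
    where
    open ≡-Reasoning
    π̂ : Fin (n * n) → Fin (n * n)
    π̂ = flatten ∘ π ∘ remQuot n
    π̂-inj : Injective π̂
    π̂-inj k l eq = begin
      k                        ≡⟨ combine-remQuot {n} n k ⟨
      flatten (remQuot n k)    ≡⟨ cong flatten (π-inj _ _ πk≡πl) ⟩
      flatten (remQuot n l)    ≡⟨ combine-remQuot {n} n l ⟩
      l                        ∎
      where
      πk≡πl : π (remQuot n k) ≡ π (remQuot n l)
      πk≡πl = trans (sym (remQuot-flatten _)) (trans (cong (remQuot n) eq) (remQuot-flatten _))

  ∑²-swap : (h : Dart n → ℕ) → ∑² (h ∘ swap) ≡ ∑² h
  ∑²-swap = ∑²-∘-injective swap λ { _ _ refl → refl }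

  restrict : (Dart n → Bool) → (Dart n → ℕ) → Dart n → ℕ
  restrict P h d = if P d then h d else 0

  -- Extending π by the identity off P gives an injection of all pairs.
  ∑²-restrict-∘-injective : (P : Dart n → Bool) (π : Dart n → Dart n) →
    (∀ d → P d ≡ true → P (π d) ≡ true) →
    (∀ d d′ → P d ≡ true → P d′ ≡ true → π d ≡ π d′ → d ≡ d′) →
    (h : Dart n → ℕ) → ∑² (restrict P (h ∘ π)) ≡ ∑² (restrict P h)
  ∑²-restrict-∘-injective P π π-closed π-inj h =
    trans (∑²-cong restrict-∘) (∑²-∘-injective π̃ π̃-inj (restrict P h))
    where
    π̃ : Dart n → Dart n
    π̃ d = if P d then π d else d
    restrict-∘ : ∀ d → restrict P (h ∘ π) d ≡ restrict P h (π̃ d)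
    restrict-∘ d with P d in Pd
    ... | true  rewrite π-closed d Pd = refl
    ... | false rewrite Pd = refl
    π̃-inj : ∀ d d′ → π̃ d ≡ π̃ d′ → d ≡ d′
    π̃-inj d d′ eq with P d in Pd | P d′ in Pd′
    ... | true  | true  = π-inj d d′ Pd Pd′ eq
    ... | true  | false with () ← trans (sym (π-closed d Pd)) (trans (cong P eq) Pd′)
    ... | false | true  with () ← trans (sym (π-closed d′ Pd′)) (trans (cong P (sym eq)) Pd)
    ... | false | false = eq

countF-none : ∀ {m} (p : Fin m → Bool) → (∀ x → p x ≡ false) → countF p ≡ 0
countF-none {zero}  p ¬p = refl
countF-none {suc m} p ¬p rewrite ¬p zero = countF-none (p ∘ suc) (¬p ∘ suc)

anyF-none : ∀ {m} (p : Fin m → Bool) → (∀ x → p x ≡ false) → anyF p ≡ false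
anyF-none {zero}  p ¬p = refl
anyF-none {suc m} p ¬p rewrite ¬p zero = anyF-none (p ∘ suc) (¬p ∘ suc)

countF-≟ : ∀ {m} (b : Fin m) → countF (λ x → does (x Fin.≟ b)) ≡ 1
countF-≟ {suc m} zero    = cong suc (countF-none {m} (λ _ → false) (λ _ → refl))
countF-≟         (suc b) = countF-≟ b

countF-mono : ∀ {m} {p q : Fin m → Bool} → (∀ x → p x ≡ true → q x ≡ true) → countF p ≤ countF q
countF-mono {zero}          p⇒q = z≤n
countF-mono {suc m} {p} {q} p⇒q with p zero in p₀ | q zero in q₀
... | false | b     = ≤-trans (countF-mono (p⇒q ∘ suc)) (m≤n+m _ (ind b))
... | true  | true  = s≤s (countF-mono (p⇒q ∘ suc))
... | true  | false with () ← trans (sym (p⇒q zero p₀)) q₀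

countF-∨ : ∀ {m} (p q : Fin m → Bool) → countF (λ x → p x ∨ q x) ≤ countF p + countF q
countF-∨ {m} p q = begin
  countF (λ x → p x ∨ q x)           ≡⟨ countF≡sum {m} _ ⟩
  sum (λ x → ind (p x ∨ q x))        ≤⟨ sum-mono (λ x → ind-∨ (p x) (q x)) ⟩
  sum (λ x → ind (p x) + ind (q x))  ≡⟨ ∑-distrib-+ (ind ∘ p) (ind ∘ q) ⟩
  sum (ind ∘ p) + sum (ind ∘ q)      ≡⟨ cong₂ _+_ (countF≡sum p) (countF≡sum q) ⟨
  countF p + countF q                ∎
  where
  open ≤-Reasoning
  ind-∨ : ∀ a b → ind (a ∨ b) ≤ ind a + ind b
  ind-∨ true  b = s≤s z≤n
  ind-∨ false b = ≤-refl

countBelow : ℕ → (ℕ → Bool) → ℕ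
countBelow zero    P = 0
countBelow (suc k) P = ind (P k) + countBelow k P

countBelow-none : ∀ s P → (∀ i → i < s → P i ≡ false) → countBelow s P ≡ 0
countBelow-none zero    P ¬P = refl
countBelow-none (suc s) P ¬P rewrite ¬P s ≤-refl = countBelow-none s P (λ i i<s → ¬P i (m<n⇒m<1+n i<s))

countBelow-≤1 : ∀ s P → (∀ i j → i < j → j < s → P i ≡ true → P j ≡ true → ⊥) → countBelow s P ≤ 1
countBelow-≤1 zero    P unique = z≤n
countBelow-≤1 (suc s) P unique with P s in Ps
... | true  = ≤-reflexive (cong suc (countBelow-none s P below))
  where
  below : ∀ i → i < s → P i ≡ false
  below i i<s with P i in Pi
  ... | false = refl
  ... | true  = ⊥-elim (unique i s i<s ≤-refl Pi Ps)
... | false = countBelow-≤1 s P (λ i j i<j j<s → unique i j i<j (m<n⇒m<1+n j<s))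

countBelow-+ : ∀ s k P → countBelow (s + k) P ≡ countBelow s (λ i → P (k + i)) + countBelow k P
countBelow-+ zero    k P = refl
countBelow-+ (suc s) k P = trans (cong₂ _+_ (cong (ind ∘ P) (+-comm s k)) (countBelow-+ s k P))
                                 (sym (+-assoc (ind (P (k + s))) _ _))

countBelow-* : ∀ s P → (∀ t → countBelow s (λ i → P (t + i)) ≤ 1) → ∀ m → countBelow (m * s) P ≤ m
countBelow-* s P window zero    = z≤n
countBelow-* s P window (suc m) =
  ≤-trans (≤-reflexive (countBelow-+ s (m * s) P))
          (+-mono-≤ (window (m * s)) (countBelow-* s P window m))

allBelow-sound : ∀ m (p : ℕ → Bool) → allBelow m p ≡ true → ∀ k → k < m → p k ≡ true
allBelow-sound (suc m) p all k k<1+m with p m in pm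
... | true with m≤n⇒m<n∨m≡n (≤-pred k<1+m)
...   | inj₁ k<m  = allBelow-sound m p all k k<m
...   | inj₂ refl = pm

iter-+ : ∀ {A : Set} (f : A → A) a b x → iter f (a + b) x ≡ iter f a (iter f b x)
iter-+ f zero    b x = refl
iter-+ f (suc a) b x = cong f (iter-+ f a b x)

iter-comm : ∀ {A : Set} (f : A → A) a b x → iter f a (iter f b x) ≡ iter f b (iter f a x)
iter-comm f a b x =
  trans (sym (iter-+ f a b x)) (trans (cong (λ k → iter f k x) (+-comm a b)) (iter-+ f b a x))

allPairs-lookup : ∀ {A : Set} {R : A → A → Set} → (∀ {x y} → R x y → R y x) →
  ∀ {k} {xs : Vec A k} → AllPairs R xs → ∀ i j → i ≢ j → R (lookup xs i) (lookup xs j)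
allPairs-lookup R-sym (Rx ∷ Rxs) zero    zero    i≢j = ⊥-elim (i≢j refl)
allPairs-lookup R-sym (Rx ∷ Rxs) zero    (suc j) i≢j = lookup⁺ Rx j
allPairs-lookup R-sym (Rx ∷ Rxs) (suc i) zero    i≢j = R-sym (lookup⁺ Rx i)
allPairs-lookup R-sym (Rx ∷ Rxs) (suc i) (suc j) i≢j = allPairs-lookup R-sym Rxs i j (i≢j ∘ cong suc)

module _ {n : ℕ} (G : Graph n) where

  Adjacent : Fin n → Fin n → Set
  Adjacent u v = adj G u v ≡ true

  adjacent-sym : ∀ {u v} → Adjacent u v → Adjacent v u
  adjacent-sym {u} {v} uv = trans (Graph.sym G v u) uv

  adjacent-≢ : ∀ {u v} → Adjacent u v → u ≢ v
  adjacent-≢ {u} uu refl with () ← trans (sym uu) (irrefl G u)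

  clique⇒K4 : (vs : Vec (Fin n) 4) → AllPairs Adjacent vs → ContainsK4 G
  clique⇒K4 vs clique =
    lookup vs , lookup-injective (AllPairs.map adjacent-≢ clique) , allPairs-lookup adjacent-sym clique

  cycle+chord⇒Θ5 : ∀ {a b c d e} → Unique (a ∷ b ∷ c ∷ d ∷ e ∷ []) →
    Adjacent a b → Adjacent b c → Adjacent c d → Adjacent d e → Adjacent e a → Adjacent a c →
    ContainsΘ5 G
  cycle+chord⇒Θ5 {a} {b} {c} {d} {e} distinct ab bc cd de ea ac =
    lookup (a ∷ b ∷ c ∷ d ∷ e ∷ []) , lookup-injective distinct , ab , bc , cd , de , ea , ac

  arc? : Dart n → Bool
  arc? (u , v) = adj G u v

  Arc : Dart n → Set
  Arc d = arc? d ≡ true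

  ∑arc : (Dart n → ℕ) → ℕ
  ∑arc h = ∑² (restrict arc? h)

  ∑arc-mono : {f g : Dart n → ℕ} → (∀ d → Arc d → f d ≤ g d) → ∑arc f ≤ ∑arc g
  ∑arc-mono {f} {g} f≤g = ∑²-mono pointwise
    where
    pointwise : ∀ d → restrict arc? f d ≤ restrict arc? g d
    pointwise d with arc? d in arc
    ... | true  = f≤g d arc
    ... | false = z≤n

  ∑arc-distrib-+ : (f g : Dart n → ℕ) → ∑arc (λ d → f d + g d) ≡ ∑arc f + ∑arc g
  ∑arc-distrib-+ f g = trans (∑²-cong pointwise) (∑²-distrib-+ (restrict arc? f) (restrict arc? g))
    where
    pointwise : ∀ d → restrict arc? (λ d → f d + g d) d ≡ restrict arc? f d + restrict arc? g d
    pointwise d with arc? d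
    ... | true  = refl
    ... | false = refl

  *-distribˡ-∑arc : (c : ℕ) (f : Dart n → ℕ) → c * ∑arc f ≡ ∑arc (λ d → c * f d)
  *-distribˡ-∑arc c f = trans (*-distribˡ-∑² c (restrict arc? f)) (∑²-cong pointwise)
    where
    pointwise : ∀ d → c * restrict arc? f d ≡ restrict arc? (λ d → c * f d) d
    pointwise d with arc? d
    ... | true  = refl
    ... | false = *-zeroʳ c

  ∑arc-∘swap : (h : Dart n → ℕ) → ∑arc (h ∘ swap) ≡ ∑arc h
  ∑arc-∘swap = ∑²-restrict-∘-injective arc? swap (λ _ → adjacent-sym) (λ { _ _ _ _ refl → refl })

  ∑arc-1 : ∑arc (λ _ → 1) ≡ e G + e G
  ∑arc-1 = begin
    ∑arc (λ _ → 1)                                ≡⟨ ∑²-cong arc-split ⟩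
    ∑² (λ d → ascending d + ascending (swap d))    ≡⟨ ∑²-distrib-+ ascending (ascending ∘ swap) ⟩
    ∑² ascending + ∑² (ascending ∘ swap)          ≡⟨ cong (∑² ascending +_) (∑²-swap ascending) ⟩
    ∑² ascending + ∑² ascending                   ≡⟨ cong₂ _+_ e≡∑² e≡∑² ⟨
    e G + e G                                     ∎
    where
    open ≡-Reasoning
    ascending : Dart n → ℕ
    ascending (u , v) = ind ((suc (toℕ u) ≤ᵇ toℕ v) ∧ adj G u v)
    e≡∑² : e G ≡ ∑² ascending
    e≡∑² = trans (sumF≡sum {n} _) (sum-cong-≗ {n} λ u → countF≡sum {n} _)
    arc-split : ∀ d → restrict arc? (λ _ → 1) d ≡ ascending d + ascending (swap d)
    arc-split (u , v) rewrite Graph.sym G v u with adj G u v in uv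
    ... | true  rewrite ∧-identityʳ (suc (toℕ u) ≤ᵇ toℕ v) | ∧-identityʳ (suc (toℕ v) ≤ᵇ toℕ u)
      = sym (ind-<ᵇ-connex (adjacent-≢ uv ∘ toℕ-injective))
    ... | false rewrite ∧-zeroʳ (suc (toℕ u) ≤ᵇ toℕ v) | ∧-zeroʳ (suc (toℕ v) ≤ᵇ toℕ u) = refl

data FaceShape : Set where
  triangle quadrangle large : FaceShape

capacity : FaceShape → ℕ
capacity triangle   = 100
capacity quadrangle = 75
capacity large      = 60

acrossCharge : FaceShape → FaceShape → ℕ
acrossCharge large triangle = 24
acrossCharge _     _        = 0

alongCharge : FaceShape → FaceShape → ℕ
alongCharge triangle large = 8
alongCharge _        _     = 0

module FaceTracing {n : ℕ} {G : Graph n} (R : RotationSystem G) where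

  φ : Dart n → Dart n
  φ = faceStep R

  φ^ : ℕ → Dart n → Dart n
  φ^ k = iter φ k

  φ≡⇒ρ≡ : ∀ {z w a b} → φ (z , w) ≡ (a , b) → w ≡ a × ρ R a z ≡ b
  φ≡⇒ρ≡ refl = refl , refl

  _≟ᴰ_ : (d d′ : Dart n) → Dec (d ≡ d′)
  _≟ᴰ_ = ≡-dec Fin._≟_ Fin._≟_

  φ-Arc : ∀ d → Arc G d → Arc G (φ d)
  φ-Arc (u , v) uv = closed R v u (adjacent-sym G uv)

  φ^-Arc : ∀ k d → Arc G d → Arc G (φ^ k d)
  φ^-Arc zero    d arc = arc
  φ^-Arc (suc k) d arc = φ-Arc _ (φ^-Arc k d arc)

  φ-injective : ∀ d d′ → Arc G d → Arc G d′ → φ d ≡ φ d′ → d ≡ d′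
  φ-injective (u , v) (u′ , v′) uv u′v′ eq with refl ← cong proj₁ eq =
    cong (_, v) (inj R v u u′ (adjacent-sym G uv) (adjacent-sym G u′v′) (cong proj₂ eq))

  φ^-injective : ∀ k d d′ → Arc G d → Arc G d′ → φ^ k d ≡ φ^ k d′ → d ≡ d′
  φ^-injective zero    d d′ arc arc′ eq = eq
  φ^-injective (suc k) d d′ arc arc′ eq =
    φ^-injective k d d′ arc arc′ (φ-injective _ _ (φ^-Arc k d arc) (φ^-Arc k d′ arc′) eq)

  ∑arc-∘φ : (h : Dart n → ℕ) → ∑arc G (h ∘ φ) ≡ ∑arc G h
  ∑arc-∘φ = ∑²-restrict-∘-injective (arc? G) φ φ-Arc φ-injective

  ∑arc-∘φ^ : ∀ k (h : Dart n → ℕ) → ∑arc G (h ∘ φ^ k) ≡ ∑arc G h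
  ∑arc-∘φ^ zero    h = refl
  ∑arc-∘φ^ (suc k) h = trans (∑arc-∘φ^ k (h ∘ φ)) (∑arc-∘φ h)

  -- Pigeonhole on φ^0 d, …, φ^(n * n) d, then cancel φ^i using injectivity on arcs.
  φ-period : ∀ d → Arc G d → ∃ λ p → 0 < p × p ≤ n * n × φ^ p d ≡ d
  φ-period d arc with pigeonhole (n<1+n (n * n)) (λ i → flatten (φ^ (toℕ i) d))
  ... | i , j , i<j , eq = toℕ j ∸ toℕ i , m<n⇒0<n∸m i<j ,
                           ≤-trans (m∸n≤m (toℕ j) (toℕ i)) (≤-pred (toℕ<n j)) , sym d≡φ^[j-i]d
    where
    φ^i≡φ^j : φ^ (toℕ i) d ≡ φ^ (toℕ j) d
    φ^i≡φ^j with eq₁ , eq₂ ← combine-injective _ _ _ _ eq = cong₂ _,_ eq₁ eq₂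
    d≡φ^[j-i]d : d ≡ φ^ (toℕ j ∸ toℕ i) d
    d≡φ^[j-i]d = φ^-injective (toℕ i) _ _ arc (φ^-Arc (toℕ j ∸ toℕ i) d arc) (begin
      φ^ (toℕ i) d                         ≡⟨ φ^i≡φ^j ⟩
      φ^ (toℕ j) d                         ≡⟨ cong (λ k → φ^ k d) (m+[n∸m]≡n (<⇒≤ i<j)) ⟨
      φ^ (toℕ i + (toℕ j ∸ toℕ i)) d       ≡⟨ iter-+ φ (toℕ i) _ d ⟩
      φ^ (toℕ i) (φ^ (toℕ j ∸ toℕ i) d)    ∎)
      where open ≡-Reasoning

  φ^-mod : ∀ {p d} → 0 < p → φ^ p d ≡ d → ∀ k → ∃ λ r → r < p × φ^ k d ≡ φ^ r d
  φ^-mod 0<p φ^pd≡d zero = 0 , 0<p , refl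
  φ^-mod {p} {d} 0<p φ^pd≡d (suc k) with φ^-mod 0<p φ^pd≡d k
  ... | r , r<p , eq with m≤n⇒m<n∨m≡n r<p
  ... | inj₁ 1+r<p = suc r , 1+r<p , cong φ eq
  ... | inj₂ 1+r≡p = 0 , 0<p , trans (cong φ eq) (trans (cong (λ t → φ^ t d) 1+r≡p) φ^pd≡d)

  key-injective : ∀ d d′ → key d ≡ key d′ → d ≡ d′
  key-injective d d′ eq = begin
    d                         ≡⟨ remQuot-flatten d ⟨
    remQuot n (flatten d)     ≡⟨ cong (remQuot n) (toℕ-injective flat-eq) ⟩
    remQuot n (flatten d′)    ≡⟨ remQuot-flatten d′ ⟩
    d′                        ∎
    where
    open ≡-Reasoning
    key≡toℕ-flatten : ∀ d → key d ≡ toℕ (flatten d)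
    key≡toℕ-flatten (u , v) = trans (cong (_+ toℕ v) (*-comm (toℕ u) n)) (sym (toℕ-combine u v))
    flat-eq : toℕ (flatten d) ≡ toℕ (flatten d′)
    flat-eq = trans (sym (key≡toℕ-flatten d)) (trans eq (key≡toℕ-flatten d′))

  FaceRep : Dart n → Set
  FaceRep d = isFaceRep R d ≡ true

  faceRep-minimal : ∀ {d} → FaceRep d → ∀ k → k < n * n → key d ≤ key (φ^ k d)
  faceRep-minimal rep k k<n² = ≤ᵇ⇒≤ _ _ (Equivalence.from T-≡ (allBelow-sound (n * n) _ rep k k<n²))

  faceRep-unique : ∀ {d} k → Arc G d → FaceRep d → FaceRep (φ^ k d) → φ^ k d ≡ d
  faceRep-unique {d} k arc rep rep′ with φ-period d arc
  ... | p , 0<p , p≤n² , φ^pd≡d with φ^-mod 0<p φ^pd≡d k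
  ... | zero  , _   , φ^kd≡d    = φ^kd≡d
  ... | suc r , r<p , φ^kd≡φ^rd = sym (key-injective d d′ (≤-antisym key-d≤ key-d′≤))
    where
    d′ = φ^ k d
    key-d≤ : key d ≤ key d′
    key-d≤ = subst (λ x → key d ≤ key x) (sym φ^kd≡φ^rd)
      (faceRep-minimal rep (suc r) (<-≤-trans r<p p≤n²))
    φ^[p-r]d′≡d : φ^ (p ∸ suc r) d′ ≡ d
    φ^[p-r]d′≡d = begin
      φ^ (p ∸ suc r) d′               ≡⟨ cong (φ^ (p ∸ suc r)) φ^kd≡φ^rd ⟩
      φ^ (p ∸ suc r) (φ^ (suc r) d)   ≡⟨ iter-+ φ (p ∸ suc r) (suc r) d ⟨
      φ^ (p ∸ suc r + suc r) d        ≡⟨ cong (λ t → φ^ t d) (m∸n+n≡m (<⇒≤ r<p)) ⟩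
      φ^ p d                          ≡⟨ φ^pd≡d ⟩
      d                               ∎
      where open ≡-Reasoning
    key-d′≤ : key d′ ≤ key d
    key-d′≤ = subst (λ x → key d′ ≤ key x) φ^[p-r]d′≡d
      (faceRep-minimal rep′ (p ∸ suc r) (<-≤-trans (∸-monoʳ-< {p} {suc r} {0} (s≤s z≤n) (<⇒≤ r<p)) p≤n²))

  NoPeriodBelow : ℕ → Dart n → Set
  NoPeriodBelow s d = ∀ k → 0 < k → k < s → φ^ k d ≢ d

  noPeriodBelow-suc : ∀ {s d} → NoPeriodBelow s d → φ^ s d ≢ d → NoPeriodBelow (suc s) d
  noPeriodBelow-suc aperiodic φ^sd≢d k 0<k k<1+s with m≤n⇒m<n∨m≡n (≤-pred k<1+s)
  ... | inj₁ k<s  = aperiodic k 0<k k<s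
  ... | inj₂ refl = φ^sd≢d

  faceRepsAlong : ℕ → Dart n → ℕ
  faceRepsAlong k d = countBelow k (λ i → isFaceRep R (φ^ i d))

  faceRepsInWindow-≤1 : ∀ s {d} → Arc G d → NoPeriodBelow s d →
                        ∀ t → countBelow s (λ i → isFaceRep R (φ^ (t + i) d)) ≤ 1
  faceRepsInWindow-≤1 s {d} arc aperiodic t = countBelow-≤1 s _ two-reps-absurd
    where
    shuffle : ∀ t x i → t + (x + i) ≡ x + (t + i)
    shuffle = solve-∀
    two-reps-absurd : ∀ i j → i < j → j < s → FaceRep (φ^ (t + i) d) → FaceRep (φ^ (t + j) d) → ⊥
    two-reps-absurd i j i<j j<s rep rep′ =
      aperiodic (j ∸ i) (m<n⇒0<n∸m i<j) (≤-<-trans (m∸n≤m j i) j<s) φ^[j-i]d≡d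
      where
      x = φ^ (t + i) d
      φ^[t+j]d≡φ^[j-i]x : φ^ (t + j) d ≡ φ^ (j ∸ i) x
      φ^[t+j]d≡φ^[j-i]x = begin
        φ^ (t + j) d              ≡⟨ cong (λ k → φ^ (t + k) d) (m∸n+n≡m (<⇒≤ i<j)) ⟨
        φ^ (t + (j ∸ i + i)) d    ≡⟨ cong (λ k → φ^ k d) (shuffle t (j ∸ i) i) ⟩
        φ^ (j ∸ i + (t + i)) d    ≡⟨ iter-+ φ (j ∸ i) (t + i) d ⟩
        φ^ (j ∸ i) x              ∎
        where open ≡-Reasoning
      φ^[j-i]x≡x : φ^ (j ∸ i) x ≡ x
      φ^[j-i]x≡x =
        faceRep-unique (j ∸ i) (φ^-Arc (t + i) d arc) rep (subst FaceRep φ^[t+j]d≡φ^[j-i]x rep′)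
      φ^[j-i]d≡d : φ^ (j ∸ i) d ≡ d
      φ^[j-i]d≡d = φ^-injective (t + i) _ _ (φ^-Arc (j ∸ i) d arc) arc
        (trans (iter-comm φ (t + i) (j ∸ i) d) φ^[j-i]x≡x)

  faceRepsAlong-≤ : ∀ s m {k d} → m * s ≡ k → Arc G d → NoPeriodBelow s d → faceRepsAlong k d ≤ m
  faceRepsAlong-≤ s m refl arc aperiodic = countBelow-* s _ (faceRepsInWindow-≤1 s arc aperiodic) m

  faces≡∑arc : faces R ≡ ∑arc G (ind ∘ isFaceRep R)
  faces≡∑arc = trans (sumF≡sum {n} _) (sum-cong-≗ {n} λ u →
                 trans (countF≡sum {n} _) (sum-cong-≗ {n} λ v → ind-∧ (adj G u v) _))
    where
    ind-∧ : ∀ a b → ind (a ∧ b) ≡ (if a then ind b else 0)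
    ind-∧ true  b = refl
    ind-∧ false b = refl

  ∑arc-faceRepsAlong : ∀ m → ∑arc G (faceRepsAlong m) ≡ m * faces R
  ∑arc-faceRepsAlong zero    = sym (*-distribˡ-∑arc G 0 (λ _ → 0))
  ∑arc-faceRepsAlong (suc m) = begin
    ∑arc G (λ d → ind (isFaceRep R (φ^ m d)) + faceRepsAlong m d)
      ≡⟨ ∑arc-distrib-+ G (ind ∘ isFaceRep R ∘ φ^ m) (faceRepsAlong m) ⟩
    ∑arc G (ind ∘ isFaceRep R ∘ φ^ m) + ∑arc G (faceRepsAlong m)
      ≡⟨ cong₂ _+_ (trans (∑arc-∘φ^ m (ind ∘ isFaceRep R)) (sym faces≡∑arc)) (∑arc-faceRepsAlong m) ⟩
    faces R + m * faces R
      ∎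
    where open ≡-Reasoning

  ρ-orbit-closed : ∀ {v u} (S : Fin n → Set) → Adjacent G v u → S u → (∀ x → S x → S (ρ R v x)) →
                   ∀ w → Adjacent G v w → S w
  ρ-orbit-closed {v} {u} S vu Su S-closed w vw with k , ρ^ku≡w ← cyclic R v u w vu vw =
    subst S ρ^ku≡w (S-iter k)
    where
    S-iter : ∀ k → S (iter (ρ R v) k u)
    S-iter zero    = Su
    S-iter (suc k) = S-closed _ (S-iter k)

  ρ-fixed⇒deg≤1 : ∀ {v u} → Adjacent G v u → ρ R v u ≡ u → deg G v ≤ 1
  ρ-fixed⇒deg≤1 {v} {u} vu ρu≡u = begin
    countF (adj G v)                  ≤⟨ countF-mono (λ w vw → dec-true (w Fin.≟ u) (only-u w vw)) ⟩
    countF (λ w → does (w Fin.≟ u))   ≡⟨ countF-≟ u ⟩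
    1                                 ∎
    where
    open ≤-Reasoning
    only-u : ∀ w → Adjacent G v w → w ≡ u
    only-u = ρ-orbit-closed (_≡ u) vu refl (λ { x refl → ρu≡u })

  ρ-2-cycle⇒deg≤2 : ∀ {v u w} → Adjacent G v u → ρ R v u ≡ w → ρ R v w ≡ u → deg G v ≤ 2
  ρ-2-cycle⇒deg≤2 {v} {u} {w} vu ρu≡w ρw≡u = begin
    countF (adj G v)                                     ≤⟨ countF-mono u-or-w ⟩
    countF (λ x → is u x ∨ is w x)                       ≤⟨ countF-∨ (is u) (is w) ⟩
    countF (is u) + countF (is w)                        ≡⟨ cong₂ _+_ (countF-≟ u) (countF-≟ w) ⟩
    2                                                    ∎
    where
    open ≤-Reasoning
    is : Fin n → Fin n → Bool
    is y x = does (x Fin.≟ y)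
    S : Fin n → Set
    S x = x ≡ u ⊎ x ≡ w
    S-closed : ∀ x → S x → S (ρ R v x)
    S-closed x (inj₁ refl) = inj₂ ρu≡w
    S-closed x (inj₂ refl) = inj₁ ρw≡u
    u-or-w : ∀ x → Adjacent G v x → is u x ∨ is w x ≡ true
    u-or-w x vx with ρ-orbit-closed S vu (inj₁ refl) S-closed x vx
    ... | inj₁ refl = cong (_∨ is w x) (dec-true (x Fin.≟ x) refl)
    ... | inj₂ refl = trans (cong (is u x ∨_) (dec-true (x Fin.≟ x) refl)) (∨-zeroʳ _)

  Triangle : Dart n → Set
  Triangle d = φ^ 3 d ≡ d

  Quadrangle : Dart n → Set
  Quadrangle d = φ^ 4 d ≡ d

  triangle-φ : ∀ {d} → Triangle d → Triangle (φ d)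
  triangle-φ = cong φ

  shape : Dart n → FaceShape
  shape d with φ^ 3 d ≟ᴰ d | φ^ 4 d ≟ᴰ d
  ... | yes _ | _     = triangle
  ... | no _  | yes _ = quadrangle
  ... | no _  | no _  = large

  data ShapeSpec (d : Dart n) : FaceShape → Set where
    triangle   : Triangle d → ShapeSpec d triangle
    quadrangle : ¬ Triangle d → Quadrangle d → ShapeSpec d quadrangle
    large      : ¬ Triangle d → ¬ Quadrangle d → ShapeSpec d large

  shape-spec : ∀ d → ShapeSpec d (shape d)
  shape-spec d with φ^ 3 d ≟ᴰ d | φ^ 4 d ≟ᴰ d
  ... | yes tri | _        = triangle tri
  ... | no ¬tri | yes quad = quadrangle ¬tri quad
  ... | no ¬tri | no ¬quad = large ¬tri ¬quad

  module MinDegree3 (δ₃ : MinDegAtLeast 3 G) where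

    ρ-no-fixed-point : ∀ {v u} → Adjacent G v u → ρ R v u ≢ u
    ρ-no-fixed-point {v} vu ρu≡u = <⇒≱ (s≤s (s≤s z≤n)) (≤-trans (δ₃ v) (ρ-fixed⇒deg≤1 vu ρu≡u))

    ρ-no-2-cycle : ∀ {v u w} → Adjacent G v u → ρ R v u ≡ w → ρ R v w ≢ u
    ρ-no-2-cycle {v} vu ρu≡w ρw≡u =
      <⇒≱ (s≤s (s≤s (s≤s z≤n))) (≤-trans (δ₃ v) (ρ-2-cycle⇒deg≤2 vu ρu≡w ρw≡u))

    faceLength≥3 : ∀ {d} → Arc G d → NoPeriodBelow 3 d
    faceLength≥3 {u , v} uv 1 _ _ φd≡d  = adjacent-≢ G uv (sym (proj₁ (φ≡⇒ρ≡ φd≡d)))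
    faceLength≥3 {u , v} uv 2 _ _ φ²d≡d = ρ-no-fixed-point (adjacent-sym G uv) (proj₁ (φ≡⇒ρ≡ φ²d≡d))
    faceLength≥3 uv (suc (suc (suc k))) _ (s≤s (s≤s (s≤s ())))

    module _ (noK₄ : ¬ ContainsK4 G) (noΘ₅ : ¬ ContainsΘ5 G) where

      -- The triangle a b c and the quadrangle b a x y form the 5-cycle b c a x y with chord ab.
      triangle-borders-no-quadrangle : ∀ {d} → Arc G d → Triangle d → ¬ Quadrangle (swap d)
      triangle-borders-no-quadrangle {a , b} ab abc bayx =
        noΘ₅ (cycle+chord⇒Θ5 G distinct bc ca ax xy yb ba)
        where
        c = ρ R b a
        x = ρ R a b
        y = ρ R x a
        ρcb≡a = proj₁ (φ≡⇒ρ≡ abc)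
        ρac≡b = proj₂ (φ≡⇒ρ≡ abc)
        ρyx≡b = proj₁ (φ≡⇒ρ≡ bayx)
        ρby≡a = proj₂ (φ≡⇒ρ≡ bayx)
        ba = adjacent-sym G ab
        bc = closed R b a ba
        ca = subst (Adjacent G c) ρcb≡a (closed R c b (adjacent-sym G bc))
        ax = closed R a b ab
        xy = closed R x a (adjacent-sym G ax)
        yb = subst (Adjacent G y) ρyx≡b (closed R y x (adjacent-sym G xy))
        distinct : Unique (b ∷ c ∷ a ∷ x ∷ y ∷ [])
        distinct = (adjacent-≢ G bc ∷ adjacent-≢ G ba ∷ (ρ-no-fixed-point ab ∘ sym) ∷
                      (adjacent-≢ G yb ∘ sym) ∷ [])
                 ∷ (adjacent-≢ G ca ∷ (λ c≡x → ρ-no-2-cycle ab (sym c≡x) ρac≡b) ∷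
                      (λ c≡y → ρ-no-2-cycle ba refl (subst (λ z → ρ R b z ≡ a) (sym c≡y) ρby≡a)) ∷ [])
                 ∷ (adjacent-≢ G ax ∷ (ρ-no-fixed-point (adjacent-sym G ax) ∘ sym) ∷ [])
                 ∷ (adjacent-≢ G xy ∷ [])
                 ∷ [] ∷ []

      -- With triangles b a x and c b y beyond the edges ab and bc of the triangle a b c,
      -- either x = y and a b c x is a K₄, or a x b y c is a 5-cycle with chord ab.
      triangle-borders-≤1-triangle : ∀ {d} → Arc G d → Triangle d → Triangle (swap d) →
                                     ¬ Triangle (swap (φ d))
      triangle-borders-≤1-triangle {a , b} ab abc bax cby = K₄-or-Θ₅ (x Fin.≟ y)
        where
        c = ρ R b a
        x = ρ R a b
        y = ρ R b c
        ρcb≡a = proj₁ (φ≡⇒ρ≡ abc)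
        ρac≡b = proj₂ (φ≡⇒ρ≡ abc)
        ρxa≡b = proj₁ (φ≡⇒ρ≡ bax)
        ρyb≡c = proj₁ (φ≡⇒ρ≡ cby)
        ba = adjacent-sym G ab
        bc = closed R b a ba
        ca = subst (Adjacent G c) ρcb≡a (closed R c b (adjacent-sym G bc))
        ax = closed R a b ab
        xb = subst (Adjacent G x) ρxa≡b (closed R x a (adjacent-sym G ax))
        by = closed R b c bc
        yc = subst (Adjacent G y) ρyb≡c (closed R y b (adjacent-sym G by))
        K₄-or-Θ₅ : Dec (x ≡ y) → ⊥
        K₄-or-Θ₅ (yes x≡y) = noK₄ (clique⇒K4 G (a ∷ b ∷ c ∷ x ∷ [])
          ((ab ∷ adjacent-sym G ca ∷ ax ∷ []) ∷ (bc ∷ adjacent-sym G xb ∷ []) ∷ (cx ∷ []) ∷ [] ∷ []))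
          where
          cx = subst (Adjacent G c) (sym x≡y) (adjacent-sym G yc)
        K₄-or-Θ₅ (no x≢y) = noΘ₅ (cycle+chord⇒Θ5 G distinct ax xb by yc ca ab)
          where
          distinct : Unique (a ∷ x ∷ b ∷ y ∷ c ∷ [])
          distinct = (adjacent-≢ G ax ∷ adjacent-≢ G ab ∷ (λ a≡y → ρ-no-2-cycle ba refl (sym a≡y)) ∷
                        (adjacent-≢ G ca ∘ sym) ∷ [])
                   ∷ (adjacent-≢ G xb ∷ x≢y ∷ (λ x≡c → ρ-no-2-cycle ab x≡c ρac≡b) ∷ [])
                   ∷ (adjacent-≢ G by ∷ adjacent-≢ G bc ∷ [])
                   ∷ (adjacent-≢ G yc ∷ [])
                   ∷ [] ∷ []

      toTriangle : Dart n → ℕ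
      toTriangle d = acrossCharge (shape d) (shape (swap d))

      toNeighbours : Dart n → ℕ
      toNeighbours d = alongCharge (shape d) (shape (swap d))

      sent : Dart n → ℕ
      sent d = toTriangle d + (toNeighbours d + toNeighbours d)

      received : Dart n → ℕ
      received d = toTriangle (swap d) + (toNeighbours (φ d) + toNeighbours (φ (φ d)))

      -- 60 is divisible by 3, 4 and 5, and 60 consecutive darts of a face of length ≥ s contain at
      -- most 60 / s representatives. The window length is passed explicitly: inferring it would
      -- unfold faceRepsAlong 60.
      capacity-bound : ∀ {d} → Arc G d → 5 * faceRepsAlong 60 d ≤ capacity (shape d)
      capacity-bound {d} arc = bound (shape-spec d)
        where
        length≥3 = faceLength≥3 arc
        bound : ∀ {s} → ShapeSpec d s → 5 * faceRepsAlong 60 d ≤ capacity s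
        bound (triangle _)        = *-monoʳ-≤ 5 (faceRepsAlong-≤ 3 20 {60} {d} refl arc length≥3)
        bound (quadrangle ¬tri _) =
          *-monoʳ-≤ 5 (faceRepsAlong-≤ 4 15 {60} {d} refl arc (noPeriodBelow-suc length≥3 ¬tri))
        bound (large ¬tri ¬quad)  =
          *-monoʳ-≤ 5 (faceRepsAlong-≤ 5 12 {60} {d} refl arc
                        (noPeriodBelow-suc (noPeriodBelow-suc length≥3 ¬tri) ¬quad))

      toNeighbours-triangle : ∀ {d} → Arc G d → Triangle d → ¬ Triangle (swap d) → toNeighbours d ≡ 8
      toNeighbours-triangle {d} arc tri ¬tri′ = charge (shape-spec d) (shape-spec (swap d))
        where
        ¬quad′ = triangle-borders-no-quadrangle arc tri
        charge : ∀ {s s′} → ShapeSpec d s → ShapeSpec (swap d) s′ → alongCharge s s′ ≡ 8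
        charge (triangle _)        (large _ _)          = refl
        charge (triangle _)        (triangle tri′)      = ⊥-elim (¬tri′ tri′)
        charge (triangle _)        (quadrangle _ quad′) = ⊥-elim (¬quad′ quad′)
        charge (quadrangle ¬tri _) _                    = ⊥-elim (¬tri tri)
        charge (large ¬tri _)      _                    = ⊥-elim (¬tri tri)

      balance : ∀ {d} → Arc G d → capacity (shape d) + sent d ≤ 84 + received d
      balance {d} arc = local {shape d} {shape (swap d)} (shape-spec d) (shape-spec (swap d))
        where
        inner = toNeighbours (φ d) + toNeighbours (φ (φ d))
        arc₁ = φ-Arc d arc
        arc₂ = φ-Arc (φ d) arc₁
        below84 : ∀ {k} → k ≤ 84 → k ≤ 84 + inner
        below84 k≤84 = ≤-trans k≤84 (m≤m+n 84 inner)
        local : ∀ {s s′} → ShapeSpec d s → ShapeSpec (swap d) s′ →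
                capacity s + (acrossCharge s s′ + (alongCharge s s′ + alongCharge s s′)) ≤
                84 + (acrossCharge s′ s + inner)
        local (large _ _)      (triangle _)         = m≤m+n 84 inner
        local (large _ _)      (quadrangle _ _)     = below84 (≤ᵇ⇒≤ 60 84 _)
        local (large _ _)      (large _ _)          = below84 (≤ᵇ⇒≤ 60 84 _)
        local (quadrangle _ _) (triangle _)         = below84 (≤ᵇ⇒≤ 75 84 _)
        local (quadrangle _ _) (quadrangle _ _)     = below84 (≤ᵇ⇒≤ 75 84 _)
        local (quadrangle _ _) (large _ _)          = below84 (≤ᵇ⇒≤ 75 84 _)
        local (triangle tri)   (quadrangle _ quad′) = ⊥-elim (triangle-borders-no-quadrangle arc tri quad′)
        local (triangle tri)   (triangle tri′)      =
          ≤-reflexive (cong₂ (λ x y → 84 + (x + y)) (sym (toNeighbours-triangle arc₁ tri₁ ¬tri₁′))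
                                                     (sym (toNeighbours-triangle arc₂ tri₂ ¬tri₂′)))
          where
          tri₁ = triangle-φ tri
          tri₂ = triangle-φ tri₁
          ¬tri₁′ = triangle-borders-≤1-triangle arc tri tri′
          ¬tri₂′ : ¬ Triangle (swap (φ (φ d)))
          ¬tri₂′ tri₂′ =
            triangle-borders-≤1-triangle arc₂ tri₂ tri₂′ (subst (Triangle ∘ swap) (sym tri) tri′)
        local (triangle tri)   (large _ _)          =
          +-monoʳ-≤ 108 (one-neighbour-charged (φ^ 3 (swap (φ d)) ≟ᴰ swap (φ d)))
          where
          tri₁ = triangle-φ tri
          tri₂ = triangle-φ tri₁
          one-neighbour-charged : Dec (Triangle (swap (φ d))) → 8 ≤ inner
          one-neighbour-charged (no ¬tri₁′) =
            ≤-trans (≤-reflexive (sym (toNeighbours-triangle arc₁ tri₁ ¬tri₁′))) (m≤m+n _ _)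
          one-neighbour-charged (yes tri₁′) =
            ≤-trans (≤-reflexive (sym (toNeighbours-triangle arc₂ tri₂ ¬tri₂′))) (m≤n+m _ _)
            where
            ¬tri₂′ = triangle-borders-≤1-triangle arc₁ tri₁ tri₁′

      transferred : ℕ
      transferred = ∑arc G toTriangle + (∑arc G toNeighbours + ∑arc G toNeighbours)

      ∑initial : ∑arc G (λ d → 5 * faceRepsAlong 60 d + sent d) ≡ 300 * faces R + transferred
      ∑initial = begin
        ∑arc G (λ d → 5 * faceRepsAlong 60 d + sent d)
          ≡⟨ ∑arc-distrib-+ G (λ d → 5 * faceRepsAlong 60 d) sent ⟩
        ∑arc G (λ d → 5 * faceRepsAlong 60 d) + ∑arc G sent
          ≡⟨ cong (_+ ∑arc G sent) (*-distribˡ-∑arc G 5 (faceRepsAlong 60)) ⟨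
        5 * ∑arc G (faceRepsAlong 60) + ∑arc G sent
          ≡⟨ cong₂ (λ r s → 5 * r + s) (∑arc-faceRepsAlong 60) ∑sent ⟩
        5 * (60 * faces R) + transferred
          ≡⟨ cong (_+ transferred) (*-assoc 5 60 (faces R)) ⟨
        300 * faces R + transferred
          ∎
        where
        open ≡-Reasoning
        ∑sent : ∑arc G sent ≡ transferred
        ∑sent = trans (∑arc-distrib-+ G toTriangle (λ d → toNeighbours d + toNeighbours d))
                      (cong (∑arc G toTriangle +_) (∑arc-distrib-+ G toNeighbours toNeighbours))

      ∑final : ∑arc G (λ d → 84 + received d) ≡ 84 * (e G + e G) + transferred
      ∑final = begin
        ∑arc G (λ d → 84 + received d)        ≡⟨ ∑arc-distrib-+ G (λ _ → 84) received ⟩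
        ∑arc G (λ _ → 84) + ∑arc G received   ≡⟨ cong₂ _+_ ∑84 ∑received ⟩
        84 * (e G + e G) + transferred        ∎
        where
        open ≡-Reasoning
        ∑84 : ∑arc G (λ _ → 84) ≡ 84 * (e G + e G)
        ∑84 = trans (sym (*-distribˡ-∑arc G 84 (λ _ → 1))) (cong (84 *_) (∑arc-1 G))
        ∑received : ∑arc G received ≡ transferred
        ∑received =
          trans (∑arc-distrib-+ G (toTriangle ∘ swap) (λ d → toNeighbours (φ d) + toNeighbours (φ^ 2 d)))
                (cong₂ _+_ (∑arc-∘swap G toTriangle)
                           (trans (∑arc-distrib-+ G (toNeighbours ∘ φ) (toNeighbours ∘ φ^ 2))
                                  (cong₂ _+_ (∑arc-∘φ toNeighbours) (∑arc-∘φ^ 2 toNeighbours))))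

      25faces≤14edges : 25 * faces R ≤ 14 * e G
      25faces≤14edges = *-cancelˡ-≤ 12 (begin
        12 * (25 * faces R)   ≡⟨ *-assoc 12 25 (faces R) ⟨
        300 * faces R         ≤⟨ +-cancelʳ-≤ transferred _ _ discharged ⟩
        84 * (e G + e G)      ≡⟨ regroup (e G) ⟩
        12 * (14 * e G)       ∎)
        where
        open ≤-Reasoning
        regroup : ∀ x → 84 * (x + x) ≡ 12 * (14 * x)
        regroup = solve-∀
        discharged : 300 * faces R + transferred ≤ 84 * (e G + e G) + transferred
        discharged = subst₂ _≤_ ∑initial ∑final (∑arc-mono G λ d arc →
          ≤-trans (+-monoˡ-≤ (sent d) (capacity-bound arc)) (balance arc))

isolated≡0 : ∀ {n} (G : Graph n) → MinDegAtLeast 1 G → isolated G ≡ 0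
isolated≡0 G δ₁ = countF-none _ (λ v → deg≢0 (δ₁ v))
  where
  deg≢0 : ∀ {k} → 1 ≤ k → (k ≡ᵇ 0) ≡ false
  deg≢0 (s≤s _) = refl

components-pos : ∀ {n} (G : Graph (suc n)) → 1 ≤ components G
components-pos {n} G =
  subst (λ b → 1 ≤ ind b + countF (isCompRep G ∘ suc)) (sym zero-isCompRep) (s≤s z≤n)
  where
  zero-isCompRep : isCompRep G zero ≡ true
  zero-isCompRep = cong not (anyF-none _ (λ w → ∧-zeroʳ (reach G (suc n) zero w)))

euler⇒edge-bound : ∀ n f m c → n + f ≡ m + 2 * c → 1 ≤ c → 25 * f ≤ 14 * m → 11 * m ≤ 25 * (n ∸ 2)
euler⇒edge-bound n f m c euler 1≤c 25f≤14m = begin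
  11 * m          ≤⟨ m+n≤o⇒m≤o∸n (11 * m) (+-cancelʳ-≤ (14 * m) (11 * m + 50) (25 * n) weighted) ⟩
  25 * n ∸ 50     ≡⟨ *-distribˡ-∸ 25 n 2 ⟨
  25 * (n ∸ 2)    ∎
  where
  open ≤-Reasoning
  m+2≤n+f : m + 2 ≤ n + f
  m+2≤n+f = subst (m + 2 ≤_) (sym euler) (+-monoʳ-≤ m (*-monoʳ-≤ 2 1≤c))
  regroup : ∀ x → 11 * x + 50 + 14 * x ≡ 25 * (x + 2)
  regroup = solve-∀
  weighted : 11 * m + 50 + 14 * m ≤ 25 * n + 14 * m
  weighted = begin
    11 * m + 50 + 14 * m   ≡⟨ regroup m ⟩
    25 * (m + 2)           ≤⟨ *-monoʳ-≤ 25 m+2≤n+f ⟩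
    25 * (n + f)           ≡⟨ *-distribˡ-+ 25 n f ⟩
    25 * n + 25 * f        ≤⟨ +-monoʳ-≤ (25 * n) 25f≤14m ⟩
    25 * n + 14 * m        ∎

open FaceTracing.MinDegree3 using (25faces≤14edges)

lemma3p2 : (n : ℕ) → 5 ≤ n → (G : Graph n) → Planar G → MinDegAtLeast 3 G →
    ¬ ContainsK4 G → ¬ ContainsΘ5 G → 11 * e G ≤ 25 * (n ∸ 2)
lemma3p2 (suc n) _ G (R , euler) δ₃ noK₄ noΘ₅ =
  euler⇒edge-bound (suc n) (faces R) (e G) (components G) euler′ (components-pos G)
                   (25faces≤14edges R δ₃ noK₄ noΘ₅)
  where
  no-isolated : isolated G ≡ 0
  no-isolated = isolated≡0 G (λ v → ≤-trans (s≤s z≤n) (δ₃ v))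
  euler′ : suc n + faces R ≡ e G + 2 * components G
  euler′ = trans (sym (+-identityʳ _)) (trans (cong (suc n + faces R +_) (sym no-isolated)) euler)
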